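{- Let $\Sigma$ be a finite graph with vertex set $V$, let $\Gamma=D(\Sigma)$, let $X\le\mathrm{Aut}(\Gamma)$ have orbits $V^+$ and $V^-$, fix $v\in V$, let $H=X_{v^+}$ and $K=X_{v^- }$, let $Y=\{x\in X\mid (v^-)^x\in\Gamma(v^+)\}$, and let $\varphi\colon V^+\cup V^-\to (X/H)\sqcup(X/K)$ map $(v^+)^x\mapsto Hx$ and $(v^-)^x\mapsto Kx$ for $x\in X$. Then: (a) $Y$ is a union of double cosets $KxH$ ($x\in X$); (b) $\varphi$ is a graph isomorphism from $\Gamma$ to $\mathrm{BiCos}(X,H,K;Y)$; (c) if $\Sigma'$ is a graph with vertex set $V$ such that $X\le\mathrm{Aut}(D(\Sigma'))$ and $\Gamma^\varphi=D(\Sigma')^\varphi$, then $\Sigma=\Sigma'$; (d) if moreover $\Sigma=\mathrm{Cay}(G,S)$ for a finite abelian group $G$ of exponent greater than $2$ and an inverse-closed $S\subseteq G$, $v=1$, and $X$ contains $R(G)$, then for each $g\in G$, $KR(g)H\subseteq Y$ if and only if $KR(g)^{ -1}H\subseteq Y$.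
   Context: Permutations act on the right, $\omega^x$ denotes the image of $\omega$ under $x$, and $X_\omega$ is a point stabilizer; $X/H$ is the set of right cosets $Hx$. $D(\Sigma)$ is the graph on $V\times\{0,1\}$ with $(u,x)\sim(w,y)$ iff $u\sim w$ in $\Sigma$ and $x\ne y$; write $u^+=(u,0)$, $u^-=(u,1)$, $V^\pm$ accordingly; $\Gamma(w)$ is the neighbourhood of $w$. For subgroups $H,K$ of a group $X$ and a union $D$ of double cosets $KdH$, the bi-coset graph $\mathrm{BiCos}(X,H,K;D)$ is the bipartite graph with parts $X/H$ and $X/K$ in which $Hx$ and $Ky$ are adjacent iff $yx^{ -1}\in D$. $\mathrm{Cay}(G,S)$ has vertex set $G$, $x\sim y$ iff $yx^{ -1}\in S$. $R(g)$ is the permutation $x\mapsto xg$ of $G$, viewed as the permutation $(x,i)\mapsto(xg,i)$ of $G\times\{0,1\}$, and $R(G)=\{R(g)\mid g\in G\}$. -}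

module Defs where

open import Data.Bool using (Bool; true; false; _∧_; _xor_)
open import Data.Nat using (ℕ; zero; suc; _≤_; _<_)
open import Data.Fin using (Fin)
open import Data.Product using (Σ; ∃; _×_; _,_; proj₁; proj₂)
open import Data.Sum using (_⊎_; inj₁; inj₂)
open import Function using (_∘_; _⇔_)
open import Function.Bundles using (_↔_; Inverse; mk↔ₛ′)
open import Relation.Binary.PropositionalEquality using (_≡_; refl; cong; trans)
open import Algebra.Structures using (IsGroup; IsAbelianGroup)

Finite : Set → Set
Finite A = Σ ℕ λ n → A ↔ Fin n

record Graph (V : Set) : Set where
  field
    adj    : V → V → Bool
    symm   : ∀ u w → adj u w ≡ adj w u
    irrefl : ∀ u → adj u u ≡ false
open Graph public

SameGraph : {V : Set} → Graph V → Graph V → Set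
SameGraph Σ₁ Σ₂ = ∀ u w → adj Σ₁ u w ≡ adj Σ₂ u w

-- The canonical double cover D(Σ) on V × {0,1}; 0 = false, 1 = true

Vert : Set → Set
Vert V = V × Bool

_⁺ : {V : Set} → V → Vert V
u ⁺ = u , false

_⁻ : {V : Set} → V → Vert V
u ⁻ = u , true

DAdj : {V : Set} → Graph V → Vert V → Vert V → Bool
DAdj Σ (u , i) (w , j) = adj Σ u w ∧ (i xor j)

Perm : Set → Set
Perm A = A ↔ A

_^_ : {A : Set} → A → Perm A → A
ω ^ x = Inverse.to x ω

-- product in right-action convention:  ω ^ (x · y) = (ω ^ x) ^ y
_·_ : {A : Set} → Perm A → Perm A → Perm A
x · y = mk↔ₛ′ (Inverse.to y ∘ Inverse.to x) (Inverse.from x ∘ Inverse.from y)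
  (λ a → trans (cong (Inverse.to y) (Inverse.strictlyInverseˡ x (Inverse.from y a)))
               (Inverse.strictlyInverseˡ y a))
  (λ a → trans (cong (Inverse.from x) (Inverse.strictlyInverseʳ y (Inverse.to x a)))
               (Inverse.strictlyInverseʳ x a))

idP : {A : Set} → Perm A
idP = mk↔ₛ′ (λ a → a) (λ a → a) (λ _ → refl) (λ _ → refl)

inv : {A : Set} → Perm A → Perm A
inv x = mk↔ₛ′ (Inverse.from x) (Inverse.to x)
  (Inverse.strictlyInverseʳ x) (Inverse.strictlyInverseˡ x)

_≈ₚ_ : {A : Set} → Perm A → Perm A → Set
x ≈ₚ y = ∀ a → a ^ x ≡ a ^ y

record IsPermGroup {A : Set} (X : Perm A → Set) : Set where
  field
    resp  : ∀ {x y} → x ≈ₚ y → X x → X y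
    id∈   : X idP
    ·∈    : ∀ {x y} → X x → X y → X (x · y)
    inv∈  : ∀ {x} → X x → X (inv x)

IsAut : {A : Set} → (A → A → Bool) → Perm A → Set
IsAut a x = ∀ p q → a (p ^ x) (q ^ x) ≡ a p q

_≤Aut_ : {A : Set} → (Perm A → Set) → (A → A → Bool) → Set
X ≤Aut a = ∀ x → X x → IsAut a x

-- the orbits of X are exactly V⁺ and V⁻ :
-- p and q lie in a common X-orbit iff they lie in the same part
HasOrbitsV± : {V : Set} → (Perm (Vert V) → Set) → Set
HasOrbitsV± {V} X =
  ∀ (p q : Vert V) → (Σ (Perm (Vert V)) λ x → X x × p ^ x ≡ q) ⇔ (proj₂ p ≡ proj₂ q)

Stab : {A : Set} → (Perm A → Set) → A → Perm A → Set
Stab X ω x = X x × ω ^ x ≡ ω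

InDoubleCoset : {A : Set} → (Perm A → Set) → Perm A → (Perm A → Set) → Perm A → Set
InDoubleCoset {A} K d H z =
  Σ (Perm A) λ k → Σ (Perm A) λ h → K k × H h × z ≈ₚ ((k · d) · h)

IsUnionOfDoubleCosets : {A : Set} → (X K H D : Perm A → Set) → Set
IsUnionOfDoubleCosets X K H D =
  (∀ z → D z → X z) × (∀ d z → D d → InDoubleCoset K d H z → D z)

-- Bi-coset graphs BiCos(X,H,K;D), on the vertex setoid (X/H) ⊔ (X/K).
-- A vertex (false , x) stands for the right coset Hx,
-- a vertex (true , x) for the right coset Kx  (x ∈ X).

BiCosV : {A : Set} → (Perm A → Set) → Set
BiCosV {A} X = Bool × Σ (Perm A) X

-- equality of cosets:  Hx = Hy iff x y⁻¹ ∈ H  (and similarly for K)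
BiCosEq : {A : Set} → (X H K : Perm A → Set) → BiCosV X → BiCosV X → Set
BiCosEq X H K (false , x , _) (false , y , _) = H (x · inv y)
BiCosEq X H K (true  , x , _) (true  , y , _) = K (x · inv y)
BiCosEq X H K _ _ = Data.Empty.⊥
  where import Data.Empty

BiCosAdj : {A : Set} → (X H K D : Perm A → Set) → BiCosV X → BiCosV X → Set
BiCosAdj X H K D (false , x , _) (true  , y , _) = D (y · inv x)
BiCosAdj X H K D (true  , y , _) (false , x , _) = D (y · inv x)
BiCosAdj X H K D _ _ = Data.Empty.⊥
  where import Data.Empty

IsBiCosIso : {A B : Set} (X H K D : Perm A → Set) (a : B → B → Bool) →
             (BiCosV X → B) → Set
IsBiCosIso {A} {B} X H K D a f =
    (∀ p q → BiCosEq X H K p q → f p ≡ f q)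
  × (∀ p q → f p ≡ f q → BiCosEq X H K p q)
  × (∀ (b : B) → Σ (BiCosV X) λ p → f p ≡ b)
  × (∀ p q → BiCosAdj X H K D p q ⇔ (a (f p) (f q) ≡ true))

-- The map φ of the lemma.  φ sends (v⁺)^x ↦ Hx and (v⁻)^x ↦ Kx; we
-- describe it through its inverse  Hx ↦ (v⁺)^x,  Kx ↦ (v⁻)^x.

φ⁻¹ : {V : Set} (X : Perm (Vert V) → Set) → V → BiCosV X → Vert V
φ⁻¹ X v (false , x , _) = (v ⁺) ^ x
φ⁻¹ X v (true  , x , _) = (v ⁻) ^ x

ImageAdj : {V : Set} (X : Perm (Vert V) → Set) → V →
           (Vert V → Vert V → Bool) → BiCosV X → BiCosV X → Bool
ImageAdj X v a p q = a (φ⁻¹ X v p) (φ⁻¹ X v q)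

module _ {G : Set} (_∙_ : G → G → G) (ε : G) where

  pow : G → ℕ → G
  pow g zero    = ε
  pow g (suc n) = pow g n ∙ g

  IsExponent : ℕ → Set
  IsExponent e = (0 < e) × (∀ g → pow g e ≡ ε)
               × (∀ e' → 0 < e' → (∀ g → pow g e' ≡ ε) → e ≤ e')

IsCayleyOf : {G : Set} (_∙_ : G → G → G) (_⁻¹ : G → G) → Graph G → (G → Bool) → Set
IsCayleyOf _∙_ _⁻¹ Σ S = ∀ x y → adj Σ x y ≡ S (y ∙ (x ⁻¹))

InverseClosed : {G : Set} (_⁻¹ : G → G) → (G → Bool) → Set
InverseClosed _⁻¹ S = ∀ g → S g ≡ true → S (g ⁻¹) ≡ true

module _ {G : Set} {_∙_ : G → G → G} {ε : G} {_⁻¹ : G → G}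
         (isG : IsGroup _≡_ _∙_ ε _⁻¹) where
  open IsGroup isG using (assoc; inverseˡ; inverseʳ; identityʳ)

  R : G → Perm (Vert G)
  R g = mk↔ₛ′ (λ { (x , i) → (x ∙ g , i) }) (λ { (x , i) → (x ∙ (g ⁻¹) , i) })
    (λ { (x , i) → cong (_, i) (trans (assoc x (g ⁻¹) g)
                        (trans (cong (x ∙_) (inverseˡ g)) (identityʳ x))) })
    (λ { (x , i) → cong (_, i) (trans (assoc x g (g ⁻¹))
                        (trans (cong (x ∙_) (inverseʳ g)) (identityʳ x))) })

{-# OPTIONS --safe #-}
-- Everything rests on the orbit-stabiliser correspondence. As X is transitive on
-- V⁺ and on V⁻, every vertex is some (v^±)^x, and (v^±)^x = (v^±)^y iff x y⁻¹
-- fixes v^±, so φ is a well-defined bijection. As X acts by automorphisms,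
-- (v⁺)^x ~ (v⁻)^y iff v⁺ ~ (v⁻)^(y x⁻¹), i.e. y x⁻¹ ∈ Y, which is (b); the same
-- invariance makes Y closed under K · _ · H, which is (a). Since φ is onto, Γ^φ
-- determines Γ = D(Σ), and D(Σ) determines Σ, which is (c). For (d), R(g) ∈ Y iff
-- g ∈ S and R(g)⁻¹ ∈ Y iff g⁻¹ ∈ S, and a double coset lies in Y iff its
-- representative does.
module Submission where

open import Defs
open import Data.Bool using (Bool; true; false; _∧_)
open import Data.Bool.Properties using (∧-identityʳ; ∧-zeroʳ; xor-comm)
open import Data.Empty using (⊥)
open import Data.Nat using (ℕ; _<_)
open import Data.Product using (Σ; _×_; _,_; proj₁; proj₂)
open import Function using (_⇔_; mk⇔; Equivalence)
open import Function.Bundles using (Inverse)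
open import Function.Related.Propositional using (module EquationalReasoning)
import Function.Properties.Equivalence as ⇔
open import Relation.Binary.PropositionalEquality
  using (_≡_; refl; sym; trans; cong; cong₂; subst; module ≡-Reasoning)
open import Algebra.Bundles using (Group)
open import Algebra.Structures using (IsGroup; IsAbelianGroup)
import Algebra.Properties.Group as GroupProperties

^-^-inv : {A : Set} (x : Perm A) (ω : A) → (ω ^ x) ^ inv x ≡ ω
^-^-inv x = Inverse.strictlyInverseʳ x

^-inv-^ : {A : Set} (x : Perm A) (ω : A) → (ω ^ inv x) ^ x ≡ ω
^-inv-^ x = Inverse.strictlyInverseˡ x

IsAut-inv : {A : Set} {a : A → A → Bool} {x : Perm A} → IsAut a x →
            ∀ p q → a p (q ^ inv x) ≡ a (p ^ x) q
IsAut-inv {a = a} {x} aut p q = trans (sym (aut p (q ^ inv x))) (cong (a (p ^ x)) (^-inv-^ x q))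

ArcSet : {A : Set} (X : Perm A → Set) (a : A → A → Bool) (α β : A) → Perm A → Set
ArcSet X a α β x = X x × a α (β ^ x) ≡ true

InDoubleCoset-refl : {A : Set} {K H : Perm A → Set} → K idP → H idP →
                     ∀ d → InDoubleCoset K d H d
InDoubleCoset-refl k h d = idP , idP , k , h , λ _ → refl

doubleCoset⊆⇔rep∈ : {A : Set} {X K H D : Perm A → Set} → IsUnionOfDoubleCosets X K H D →
                    K idP → H idP → ∀ d → (∀ z → InDoubleCoset K d H z → D z) ⇔ D d
doubleCoset⊆⇔rep∈ (_ , closed) k h d =
  mk⇔ (λ K·d·H⊆D → K·d·H⊆D d (InDoubleCoset-refl k h d)) (λ d∈D z → closed d z d∈D)

module _ {A : Set} {X : Perm A → Set} (isPG : IsPermGroup X) where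
  open IsPermGroup isPG

  Stab-idP : ∀ ω → Stab X ω idP
  Stab-idP ω = id∈ , refl

  Stab-·inv⇔ : ∀ ω {x y} → X x → X y → Stab X ω (x · inv y) ⇔ (ω ^ x ≡ ω ^ y)
  Stab-·inv⇔ ω {x} {y} x∈X y∈X = mk⇔
    (λ (_ , fixed) → trans (sym (^-inv-^ y (ω ^ x))) (cong (_^ y) fixed))
    (λ ωx≡ωy → ·∈ x∈X (inv∈ y∈X) , trans (cong (_^ inv y) ωx≡ωy) (^-^-inv y ω))

  module _ {a : A → A → Bool} (aut : X ≤Aut a) (α β : A) where

    ArcSet-isUnionOfDoubleCosets : IsUnionOfDoubleCosets X (Stab X β) (Stab X α) (ArcSet X a α β)
    ArcSet-isUnionOfDoubleCosets = (λ _ → proj₁) , closed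
      where
      closed : ∀ d z → ArcSet X a α β d → InDoubleCoset (Stab X β) d (Stab X α) z →
               ArcSet X a α β z
      closed d z (d∈X , α~βd) (k , h , (k∈X , βk≡β) , (h∈X , αh≡α) , z≈kdh) =
        resp (λ ω → sym (z≈kdh ω)) (·∈ (·∈ k∈X d∈X) h∈X) , (begin
          a α (β ^ z)              ≡⟨ cong (a α) (z≈kdh β) ⟩
          a α (((β ^ k) ^ d) ^ h)  ≡⟨ cong (λ γ → a α ((γ ^ d) ^ h)) βk≡β ⟩
          a α ((β ^ d) ^ h)        ≡⟨ cong (λ γ → a γ ((β ^ d) ^ h)) (sym αh≡α) ⟩
          a (α ^ h) ((β ^ d) ^ h)  ≡⟨ aut h h∈X α (β ^ d) ⟩
          a α (β ^ d)              ≡⟨ α~βd ⟩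
          true                     ∎)
        where open ≡-Reasoning

    ArcSet-·inv⇔ : ∀ {x y} → X x → X y → ArcSet X a α β (y · inv x) ⇔ (a (α ^ x) (β ^ y) ≡ true)
    ArcSet-·inv⇔ {x} {y} x∈X y∈X = mk⇔
      (λ (_ , e) → trans (sym moved) e)
      (λ e → ·∈ y∈X (inv∈ x∈X) , trans moved e)
      where
      moved : a α ((β ^ y) ^ inv x) ≡ a (α ^ x) (β ^ y)
      moved = IsAut-inv {x = x} (aut x x∈X) α (β ^ y)

module _ {V : Set} (Sg : Graph V) where

  DAdj-sym : ∀ p q → DAdj Sg p q ≡ DAdj Sg q p
  DAdj-sym (u , i) (w , j) = cong₂ _∧_ (symm Sg u w) (xor-comm i j)

  DAdj-samePart : ∀ p q → proj₂ p ≡ proj₂ q → DAdj Sg p q ≡ false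
  DAdj-samePart (u , false) (w , .false) refl = ∧-zeroʳ (adj Sg u w)
  DAdj-samePart (u , true)  (w , .true)  refl = ∧-zeroʳ (adj Sg u w)

  DAdj-⁺⁻ : ∀ u w → DAdj Sg (u ⁺) (w ⁻) ≡ adj Sg u w
  DAdj-⁺⁻ u w = ∧-identityʳ (adj Sg u w)

DAdj-injective : {V : Set} {Sg Sg' : Graph V} →
                 (∀ p q → DAdj Sg p q ≡ DAdj Sg' p q) → SameGraph Sg Sg'
DAdj-injective {Sg = Sg} {Sg'} same u w =
  trans (sym (DAdj-⁺⁻ Sg u w)) (trans (same (u ⁺) (w ⁻)) (DAdj-⁺⁻ Sg' u w))

agree-on-image : {B C : Set} {f : B → C} {a b : C → C → Bool} →
                 (∀ c → Σ B λ p → f p ≡ c) →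
                 (∀ p q → a (f p) (f q) ≡ b (f p) (f q)) → ∀ s t → a s t ≡ b s t
agree-on-image onto same s t with onto s | onto t
... | p , refl | q , refl = same p q

part-invariant : {V : Set} {X : Perm (Vert V) → Set} → HasOrbitsV± X →
                 ∀ {x} → X x → ∀ p → proj₂ (p ^ x) ≡ proj₂ p
part-invariant orbits {x} x∈X p = sym (Equivalence.to (orbits p (p ^ x)) (x , x∈X , refl))

module _ {V : Set} (Sg : Graph V) {X : Perm (Vert V) → Set} (isPG : IsPermGroup X)
         (aut : X ≤Aut DAdj Sg) (orbits : HasOrbitsV± X) (v : V) where

  private
    H K Y : Perm (Vert V) → Set
    H = Stab X (v ⁺)
    K = Stab X (v ⁻)
    Y = ArcSet X (DAdj Sg) (v ⁺) (v ⁻)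
    φ : BiCosV X → Vert V
    φ = φ⁻¹ X v

  φ⁻¹-part : ∀ p → proj₂ (φ p) ≡ proj₁ p
  φ⁻¹-part (false , x , x∈X) = part-invariant orbits x∈X (v ⁺)
  φ⁻¹-part (true  , x , x∈X) = part-invariant orbits x∈X (v ⁻)

  φ⁻¹-wellDefined : ∀ p q → BiCosEq X H K p q → φ p ≡ φ q
  φ⁻¹-wellDefined (false , x , x∈X) (false , y , y∈X) = Equivalence.to (Stab-·inv⇔ isPG (v ⁺) x∈X y∈X)
  φ⁻¹-wellDefined (true  , x , x∈X) (true  , y , y∈X) = Equivalence.to (Stab-·inv⇔ isPG (v ⁻) x∈X y∈X)

  φ⁻¹-samePart : ∀ p q → φ p ≡ φ q → proj₁ p ≡ proj₁ q
  φ⁻¹-samePart p q e = trans (sym (φ⁻¹-part p)) (trans (cong proj₂ e) (φ⁻¹-part q))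

  φ⁻¹-injective : ∀ p q → φ p ≡ φ q → BiCosEq X H K p q
  φ⁻¹-injective (false , x , x∈X) (false , y , y∈X) = Equivalence.from (Stab-·inv⇔ isPG (v ⁺) x∈X y∈X)
  φ⁻¹-injective (true  , x , x∈X) (true  , y , y∈X) = Equivalence.from (Stab-·inv⇔ isPG (v ⁻) x∈X y∈X)
  φ⁻¹-injective p@(false , _) q@(true  , _) e with () ← φ⁻¹-samePart p q e
  φ⁻¹-injective p@(true  , _) q@(false , _) e with () ← φ⁻¹-samePart p q e

  φ⁻¹-surjective : ∀ b → Σ (BiCosV X) λ p → φ p ≡ b
  φ⁻¹-surjective (u , false) with x , x∈X , e ← Equivalence.from (orbits (v ⁺) (u ⁺)) refl =
    (false , x , x∈X) , e
  φ⁻¹-surjective (u , true)  with x , x∈X , e ← Equivalence.from (orbits (v ⁻) (u ⁻)) refl =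
    (true , x , x∈X) , e

  φ⁻¹-samePart-nonadjacent : ∀ p q → proj₁ p ≡ proj₁ q → ⊥ ⇔ (DAdj Sg (φ p) (φ q) ≡ true)
  φ⁻¹-samePart-nonadjacent p q same = subst (λ b → ⊥ ⇔ (b ≡ true))
    (sym (DAdj-samePart Sg (φ p) (φ q) (trans (φ⁻¹-part p) (trans same (sym (φ⁻¹-part q))))))
    (mk⇔ (λ ()) (λ ()))

  φ⁻¹-edges : ∀ p q → BiCosAdj X H K Y p q ⇔ (DAdj Sg (φ p) (φ q) ≡ true)
  φ⁻¹-edges (false , x , x∈X) (true , y , y∈X) = ArcSet-·inv⇔ isPG aut (v ⁺) (v ⁻) x∈X y∈X
  φ⁻¹-edges (true , y , y∈X) (false , x , x∈X) =
    subst (λ b → Y (y · inv x) ⇔ (b ≡ true)) (DAdj-sym Sg ((v ⁺) ^ x) ((v ⁻) ^ y))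
      (ArcSet-·inv⇔ isPG aut (v ⁺) (v ⁻) x∈X y∈X)
  φ⁻¹-edges p@(false , _) q@(false , _) = φ⁻¹-samePart-nonadjacent p q refl
  φ⁻¹-edges p@(true  , _) q@(true  , _) = φ⁻¹-samePart-nonadjacent p q refl

  φ⁻¹-isBiCosIso : IsBiCosIso X H K Y (DAdj Sg) φ
  φ⁻¹-isBiCosIso = φ⁻¹-wellDefined , φ⁻¹-injective , φ⁻¹-surjective , φ⁻¹-edges

module _ {G : Set} {_∙_ : G → G → G} {ε : G} {_⁻¹ : G → G} where

  InverseClosed⇔ : IsGroup _≡_ _∙_ ε _⁻¹ → {S : G → Bool} → InverseClosed _⁻¹ S →
                   ∀ g → (S g ≡ true) ⇔ (S (g ⁻¹) ≡ true)
  InverseClosed⇔ isGroup {S} closed g =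
    mk⇔ (closed g) (λ e → subst (λ h → S h ≡ true) (⁻¹-involutive g) (closed (g ⁻¹) e))
    where
    group : Group _ _
    group = record { isGroup = isGroup }
    open GroupProperties group using (⁻¹-involutive)

  module _ (isAb : IsAbelianGroup _≡_ _∙_ ε _⁻¹) where
    open IsAbelianGroup isAb using (assoc; comm; inverseʳ; identityʳ)

    conjugate-abelian : ∀ u h → (u ∙ h) ∙ (u ⁻¹) ≡ h
    conjugate-abelian u h = begin
      (u ∙ h) ∙ (u ⁻¹)  ≡⟨ cong (_∙ (u ⁻¹)) (comm u h) ⟩
      (h ∙ u) ∙ (u ⁻¹)  ≡⟨ assoc h u (u ⁻¹) ⟩
      h ∙ (u ∙ (u ⁻¹))  ≡⟨ cong (h ∙_) (inverseʳ u) ⟩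
      h ∙ ε             ≡⟨ identityʳ h ⟩
      h                 ∎
      where open ≡-Reasoning

    Cayley-adj-∙ : {Sg : Graph G} {S : G → Bool} → IsCayleyOf _∙_ _⁻¹ Sg S →
                   ∀ u h → adj Sg u (u ∙ h) ≡ S h
    Cayley-adj-∙ {S = S} cayley u h = trans (cayley u (u ∙ h)) (cong S (conjugate-abelian u h))

module _ {G : Set} (Sg : Graph G) {X : Perm (Vert G) → Set} (isPG : IsPermGroup X)
         (aut : X ≤Aut DAdj Sg) {_∙_ : G → G → G} {ε : G} {_⁻¹ : G → G}
         (isAb : IsAbelianGroup _≡_ _∙_ ε _⁻¹) {S : G → Bool}
         (cayley : IsCayleyOf _∙_ _⁻¹ Sg S) (v : G) where
  open IsPermGroup isPG
  open IsAbelianGroup isAb using (isGroup)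

  private
    H K Y : Perm (Vert G) → Set
    H = Stab X (v ⁺)
    K = Stab X (v ⁻)
    Y = ArcSet X (DAdj Sg) (v ⁺) (v ⁻)

    DoubleCoset⊆Y : Perm (Vert G) → Set
    DoubleCoset⊆Y d = ∀ z → InDoubleCoset K d H z → Y z

  ArcSet-translate⇔ : ∀ {z} h → X z → (v ⁻) ^ z ≡ (v ∙ h) ⁻ → Y z ⇔ (S h ≡ true)
  ArcSet-translate⇔ {z} h z∈X vz≡vh = mk⇔ (λ (_ , e) → trans (sym adj≡S) e) (λ e → z∈X , trans adj≡S e)
    where
    adj≡S : DAdj Sg (v ⁺) ((v ⁻) ^ z) ≡ S h
    adj≡S = trans (cong (DAdj Sg (v ⁺)) vz≡vh)
                  (trans (DAdj-⁺⁻ Sg v (v ∙ h)) (Cayley-adj-∙ isAb {Sg} cayley v h))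

  doubleCoset⊆Y-R⇔R⁻¹ : InverseClosed _⁻¹ S → (∀ g → X (R isGroup g)) →
                        ∀ g → DoubleCoset⊆Y (R isGroup g) ⇔ DoubleCoset⊆Y (inv (R isGroup g))
  doubleCoset⊆Y-R⇔R⁻¹ closed R∈X g = begin
    DoubleCoset⊆Y (R isGroup g)        ∼⟨ ⊆Y⇔∈Y (R isGroup g) ⟩
    Y (R isGroup g)                    ∼⟨ ArcSet-translate⇔ g (R∈X g) refl ⟩
    S g ≡ true                         ∼⟨ InverseClosed⇔ isGroup closed g ⟩
    S (g ⁻¹) ≡ true                    ∼⟨ ⇔.sym (ArcSet-translate⇔ (g ⁻¹) (inv∈ (R∈X g)) refl) ⟩
    Y (inv (R isGroup g))              ∼⟨ ⇔.sym (⊆Y⇔∈Y (inv (R isGroup g))) ⟩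
    DoubleCoset⊆Y (inv (R isGroup g))  ∎
    where
    open EquationalReasoning
    ⊆Y⇔∈Y : ∀ d → DoubleCoset⊆Y d ⇔ Y d
    ⊆Y⇔∈Y = doubleCoset⊆⇔rep∈ (ArcSet-isUnionOfDoubleCosets isPG aut (v ⁺) (v ⁻))
                               (Stab-idP isPG (v ⁻)) (Stab-idP isPG (v ⁺))

lemma2p3 : {V : Set} → Finite V → (Sg : Graph V) →
    (X : Perm (Vert V) → Set) → IsPermGroup X → X ≤Aut DAdj Sg → HasOrbitsV± X →
    (v : V) →
    let H = Stab X (v ⁺)
        K = Stab X (v ⁻)
        Y = λ x → X x × DAdj Sg (v ⁺) ((v ⁻) ^ x) ≡ true
    in
    -- (a)
    IsUnionOfDoubleCosets X K H Y
    -- (b)  φ : (v⁺)^x ↦ Hx, (v⁻)^x ↦ Kx is an isomorphism Γ ≅ BiCos(X,H,K;Y)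
    × IsBiCosIso X H K Y (DAdj Sg) (φ⁻¹ X v)
    -- (c)
    × ((Sg' : Graph V) → X ≤Aut DAdj Sg' →
         (∀ p q → ImageAdj X v (DAdj Sg) p q ≡ ImageAdj X v (DAdj Sg') p q) →
         SameGraph Sg Sg')
    -- (d)
    × ((_∙_ : V → V → V) (ε : V) (_⁻¹ : V → V) →
         (isAb : IsAbelianGroup _≡_ _∙_ ε _⁻¹) →
         Σ ℕ (λ e → IsExponent _∙_ ε e × 2 < e) →
         (S : V → Bool) → InverseClosed _⁻¹ S → IsCayleyOf _∙_ _⁻¹ Sg S →
         v ≡ ε →
         (∀ g → X (R (IsAbelianGroup.isGroup isAb) g)) →
         ∀ g →
           (∀ z → InDoubleCoset K (R (IsAbelianGroup.isGroup isAb) g) H z → Y z)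
           ⇔ (∀ z → InDoubleCoset K (inv (R (IsAbelianGroup.isGroup isAb) g)) H z → Y z))
-- Nor is X ≤ Aut(D(Σ')) in (c), as φ is onto.
lemma2p3 _ Sg X isPG aut orbits v =
    ArcSet-isUnionOfDoubleCosets isPG aut (v ⁺) (v ⁻)
  , φ⁻¹-isBiCosIso Sg isPG aut orbits v
  , (λ Sg' _ sameImage → DAdj-injective {Sg = Sg} {Sg'}
        (agree-on-image (φ⁻¹-surjective Sg isPG aut orbits v) sameImage))
  , λ _ _ _ isAb _ S closed cayley _ R∈X →
      doubleCoset⊆Y-R⇔R⁻¹ Sg isPG aut isAb cayley v closed R∈X
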